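{- Let $p,q$ be distinct primes and let $n\ge 3$ be one of the following: $n=2^\alpha$ with $\alpha\ge2$; $n=p^\alpha$ with $\alpha\ge1$; $n=2p$ with $p>2$; or $n=pq$ with $2<p<q$. Then $\Gamma_N(D_n)$ is not Hamiltonian, where $D_n=\langle a,b\mid a^n=b^2=1,\ ab=ba^{ -1}\rangle$.
   Context: $\Gamma_N(G)$ denotes the simple graph whose vertices are the proper non-normal subgroups of the group $G$, two distinct vertices $H,K$ being adjacent iff $HK=KH$. A graph is Hamiltonian if it has a cycle through all its vertices. -}

module Defs where

open import Data.Nat using (ℕ; zero; suc; _+_; _∸_; _≤_)
open import Data.Nat.DivMod using (_mod_)
open import Data.Fin using (Fin; toℕ)
open import Data.Bool using (Bool; true; false; if_then_else_; _xor_)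
open import Data.Product using (Σ; ∃; _×_; _,_)
open import Relation.Binary.PropositionalEquality using (_≡_)
open import Relation.Nullary using (¬_)

-- The dihedral group D_n of order 2n: the pair (i , s) stands for a^i b^s,
-- with a^n = b^2 = 1 and b a = a^{-1} b (equivalently ab = ba^{-1}).
D : ℕ → Set
D n = Fin n × Bool

-- (a^i b^s)(a^j b^t) = a^(i ± j) b^(s xor t)
mul : ∀ {n} → D n → D n → D n
mul {suc m} (i , s) (j , t) =
  ((toℕ i + (if s then (suc m ∸ toℕ j) else toℕ j)) mod suc m) , (s xor t)

one : ∀ {n} → 3 ≤ n → D n
one {suc m} _ = (0 mod suc m) , false

inv : ∀ {n} → D n → D n
inv {suc m} (i , false) = ((suc m ∸ toℕ i) mod suc m) , false
inv {suc m} (i , true) = i , true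

Sub : ℕ → Set
Sub n = D n → Bool

_∈_ : ∀ {n} → D n → Sub n → Set
x ∈ S = S x ≡ true

Same : ∀ {n} → Sub n → Sub n → Set
Same S T = ∀ x → S x ≡ T x

IsSubgroup : ∀ {n} → 3 ≤ n → Sub n → Set
IsSubgroup h S = (one h ∈ S)
  × (∀ x y → x ∈ S → y ∈ S → mul x y ∈ S)
  × (∀ x → x ∈ S → inv x ∈ S)

Proper : ∀ {n} → Sub n → Set
Proper S = ∃ λ x → ¬ (x ∈ S)

Normal : ∀ {n} → Sub n → Set
Normal S = ∀ g x → x ∈ S → mul (mul g x) (inv g) ∈ S

-- vertices of Γ_N(D_n): proper non-normal subgroups
Vertex : ∀ {n} → 3 ≤ n → Sub n → Set
Vertex h S = IsSubgroup h S × Proper S × ¬ Normal S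

InProd : ∀ {n} → Sub n → Sub n → D n → Set
InProd H K x = ∃ λ h → ∃ λ k → h ∈ H × k ∈ K × mul h k ≡ x

Permutable : ∀ {n} → Sub n → Sub n → Set
Permutable H K = ∀ x → (InProd H K x → InProd K H x) × (InProd K H x → InProd H K x)

Adj : ∀ {n} → Sub n → Sub n → Set
Adj H K = ¬ Same H K × Permutable H K

next : ∀ {m} → Fin (suc m) → Fin (suc m)
next {m} i = suc (toℕ i) mod suc m

HamiltonianΓN : ∀ {n} → 3 ≤ n → Set
HamiltonianΓN h = Σ ℕ λ m → 3 ≤ suc m × Σ (Fin (suc m) → Sub _) λ c →
    (∀ i → Vertex h (c i))
  × (∀ i j → Same (c i) (c j) → i ≡ j)
  × (∀ H → Vertex h H → ∃ λ i → Same H (c i))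
  × (∀ i → Adj (c i) (c (next i)))

module Submission where

-- A vertex of Γ_N(D_n) contains a
-- reflection and neither a nor a² (either would make it normal). The key
-- lemma permutable-reflections: if HK = KH, all rotation exponents of H and
-- K lie in dℤ for some d ∣ n, a^u b ∈ H and a^v b ∈ K, then d ∣ 2(u − v),
-- since ((a^u b)(a^v b))² = a^(2(u−v)) lies in HK.
--
-- For n = 2^α, p^α, 2p, Bézout shows that the rotations of every vertex lie
-- in 4ℤ, pℤ, pℤ, so "contains some a^u b with s ∣ u" (s = 2, p, p) passes
-- along edges (module Invariant), and a Hamiltonian cycle would carry it from
-- {1, b} to {1, ab}. For n = pq, every neighbour of {1, a^u b} with p ∣ u is
-- ⟨a^p, b⟩ or ⟨a^q, a^u b⟩, so ⟨a^p, b⟩ would need the three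
-- cycle-neighbours {1, b}, {1, a^p b}, {1, a^2p b} (module
-- Product-of-primes).

open import Data.Bool using (Bool; true; false; _xor_; _∨_)
import Data.Bool.Properties as Boolₚ
open Boolₚ using (xor-assoc)
open import Data.Empty using (⊥; ⊥-elim)
open import Data.Fin using (Fin; toℕ; fromℕ<)
import Data.Fin.Properties as Finₚ
open import Data.Integer as ℤ using (ℤ; +_; _+_; _-_; _*_; -_)
import Data.Integer.Properties as ℤₚ
import Data.Integer.DivMod as ℤ÷
open import Data.Integer.Divisibility.Signed
  using (_∣_; divides; ∣m∣n⇒∣m+n; ∣m∣n⇒∣m-n; ∣m⇒∣m*n; ∣m⇒∣-m; ∣n⇒∣m*n; ∣-trans; ∣-refl; ∣ᵤ⇒∣; ∣⇒∣ᵤ)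
open import Data.Integer.Tactic.RingSolver using (solve-∀; solve)
open import Data.List using ([]; _∷_)
open import Data.Nat as ℕ using (ℕ; zero; suc; _≤_; _<_; _^_; z≤n; s≤s)
import Data.Nat.Properties as ℕₚ
import Data.Nat.Divisibility as ℕᵈ
open import Data.Nat.DivMod using (_mod_; _%_; _/_; m≡m%n+[m/n]*n; m<n⇒m%n≡m; m%n<n)
open import Data.Nat.Coprimality using (Coprime; coprime-Bézout; coprime-divisor; prime⇒coprime)
  renaming (sym to Coprime-sym)
open import Data.Nat.Primality using (Prime; prime⇒irreducible; prime⇒nonTrivial; prime[2])
open import Data.Nat.GCD using (module Bézout)
open import Data.Product using (∃; _×_; _,_; proj₁; proj₂)
open import Data.Product.Properties using (≡-dec)
open import Data.Sum using (_⊎_; inj₁; inj₂; [_,_]′)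
open import Function using (_∘_; id)
open import Relation.Binary.PropositionalEquality
  using (_≡_; _≢_; refl; sym; trans; cong; cong₂; subst; subst₂; module ≡-Reasoning)
open import Relation.Nullary using (¬_; yes; no; Dec)
open import Relation.Nullary.Decidable using (⌊_⌋; decidable-stable; ¬?; _×-dec_)
open import Relation.Binary.Bundles using (Setoid)
import Relation.Binary.Reasoning.Setoid as SetoidReasoning

open import Defs

-- Congruence of integers modulo d, as a record so that a and b stay
-- visible to unification.
infix 4 _≡_modulo_
record _≡_modulo_ (a b d : ℤ) : Set where
  constructor congruent
  field difference : d ∣ a - b
open _≡_modulo_ public

module _ {d : ℤ} where

  ∣-≡ : ∀ {x y} → d ∣ x → x ≡ y → d ∣ y
  ∣-≡ d∣x refl = d∣x

  ≡mod-reflexive : ∀ {a b} → a ≡ b → a ≡ b modulo d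
  ≡mod-reflexive {a} refl = congruent (divides (+ 0) (solve (a ∷ d ∷ [])))

  ≡mod-refl : ∀ {a} → a ≡ a modulo d
  ≡mod-refl = ≡mod-reflexive refl

  ≡mod-sym : ∀ {a b} → a ≡ b modulo d → b ≡ a modulo d
  ≡mod-sym {a} {b} (congruent d∣a-b) =
    congruent (∣-≡ (∣m⇒∣-m d∣a-b) (solve (a ∷ b ∷ [])))

  ≡mod-trans : ∀ {a b c} → a ≡ b modulo d → b ≡ c modulo d → a ≡ c modulo d
  ≡mod-trans {a} {b} {c} (congruent d∣a-b) (congruent d∣b-c) =
    congruent (∣-≡ (∣m∣n⇒∣m+n d∣a-b d∣b-c) (solve (a ∷ b ∷ c ∷ [])))

  +-cong-mod : ∀ {a b a′ b′} → a ≡ a′ modulo d → b ≡ b′ modulo d → a + b ≡ a′ + b′ modulo d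
  +-cong-mod {a} {b} {a′} {b′} (congruent d∣a) (congruent d∣b) =
    congruent (∣-≡ (∣m∣n⇒∣m+n d∣a d∣b) (solve (a ∷ b ∷ a′ ∷ b′ ∷ [])))

  *-congˡ-mod : ∀ c {a b} → a ≡ b modulo d → c * a ≡ c * b modulo d
  *-congˡ-mod c {a} {b} (congruent d∣a-b) =
    congruent (∣-≡ (∣n⇒∣m*n c d∣a-b) (solve (c ∷ a ∷ b ∷ [])))

  ∣⇒≡0 : ∀ {a} → d ∣ a → a ≡ + 0 modulo d
  ∣⇒≡0 {a} d∣a = congruent (∣-≡ d∣a (solve (a ∷ [])))

  -‿cong-mod : ∀ {a b} → a ≡ b modulo d → - a ≡ - b modulo d
  -‿cong-mod {a} {b} (congruent d∣a-b) =
    congruent (∣-≡ (∣m⇒∣-m d∣a-b) (solve (a ∷ b ∷ [])))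

  ≡0⇒∣ : ∀ {a} → a ≡ + 0 modulo d → d ∣ a
  ≡0⇒∣ {a} (congruent d∣a-0) = ∣-≡ d∣a-0 (solve (a ∷ []))

  +-multiple : ∀ a k → a + k * d ≡ a modulo d
  +-multiple a k = congruent (divides k (solve (a ∷ k ∷ d ∷ [])))

  +-cancelˡ-mod : ∀ c {a b} → c + a ≡ c + b modulo d → a ≡ b modulo d
  +-cancelˡ-mod c {a} {b} (congruent d∣) = congruent (∣-≡ d∣ (solve (c ∷ a ∷ b ∷ [])))

  +-modulus : ∀ a → a + d ≡ a modulo d
  +-modulus a = congruent (divides (+ 1) (solve (a ∷ d ∷ [])))

≡mod-divisor : ∀ {e d a b} → e ∣ d → a ≡ b modulo d → a ≡ b modulo e
≡mod-divisor e∣d (congruent d∣a-b) = congruent (∣-trans e∣d d∣a-b)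

≡mod-setoid : ℤ → Setoid _ _
≡mod-setoid d = record
  { Carrier = ℤ
  ; _≈_ = λ a b → a ≡ b modulo d
  ; isEquivalence = record { refl = ≡mod-refl ; sym = ≡mod-sym ; trans = ≡mod-trans }
  }

module ≡mod-Reasoning (d : ℤ) = SetoidReasoning (≡mod-setoid d)

pos-+* : ∀ x y z → + (x ℕ.+ y ℕ.* z) ≡ + x + + y * + z
pos-+* x y z = trans (ℤₚ.pos-+ x (y ℕ.* z)) (cong (λ w → + x + w) (ℤₚ.pos-* y z))

pos-∸ : ∀ {a b} → b ≤ a → + (a ℕ.∸ b) ≡ + a - + b
pos-∸ {a} {b} b≤a = sym (trans (ℤₚ.m-n≡m⊖n a b) (ℤₚ.⊖-≥ b≤a))

module Residues (m : ℕ) where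

  N : ℕ
  N = suc m

  ⟦_⟧ : Fin N → ℤ
  ⟦ i ⟧ = + toℕ i

  ⟦mod⟧ : ∀ a → ⟦ a mod N ⟧ ≡ + a modulo + N
  ⟦mod⟧ a = ≡mod-sym (begin
      + a                               ≡⟨ cong +_ (m≡m%n+[m/n]*n a N) ⟩
      + (a % N ℕ.+ a / N ℕ.* N)         ≡⟨ pos-+* (a % N) (a / N) N ⟩
      + (a % N) + + (a / N) * + N       ≈⟨ +-multiple (+ (a % N)) (+ (a / N)) ⟩
      + (a % N)                         ≡⟨ cong +_ (Finₚ.toℕ-fromℕ< (m%n<n a N)) ⟨
      ⟦ a mod N ⟧                       ∎)
    where open ≡mod-Reasoning (+ N)

  small-multiple : ∀ {k} → k < N → + k ≡ + 0 modulo + N → k ≡ 0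
  small-multiple {k} k<N k≡0 =
    trans (sym (m<n⇒m%n≡m k<N)) (ℕᵈ.n∣m⇒m%n≡0 k N (∣⇒∣ᵤ (≡0⇒∣ k≡0)))

  ≢0-small : ∀ {k} → 0 < k → k < N → ¬ (+ k ≡ + 0 modulo + N)
  ≢0-small 0<k k<N k≡0 with small-multiple k<N k≡0
  ... | refl = ℕₚ.<-irrefl refl 0<k

  small-distinct : ∀ {a b} → a < b → b < N → ¬ (+ a ≡ + b modulo + N)
  small-distinct {a} {b} a<b b<N a≡b = ≢0-small (ℕₚ.m<n⇒0<n∸m a<b) (ℕₚ.≤-<-trans (ℕₚ.m∸n≤m b a) b<N)
    (∣⇒≡0 (subst (+ N ∣_) (sym (pos-∸ (ℕₚ.<⇒≤ a<b))) (difference (≡mod-sym a≡b))))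

  private
    ordered-injective : ∀ {x y} → x ≤ y → y < N → + y ≡ + x modulo + N → y ≡ x
    ordered-injective {x} {y} x≤y y<N y≡x = ℕₚ.≤-antisym (ℕₚ.m∸n≡0⇒m≤n y∸x≡0) x≤y
      where
        y-x≡y∸x : + y - + x ≡ + (y ℕ.∸ x)
        y-x≡y∸x = trans (ℤₚ.m-n≡m⊖n y x) (ℤₚ.⊖-≥ x≤y)
        y∸x≡0 : y ℕ.∸ x ≡ 0
        y∸x≡0 = small-multiple (ℕₚ.≤-<-trans (ℕₚ.m∸n≤m y x) y<N)
          (∣⇒≡0 (∣-≡ (difference y≡x) y-x≡y∸x))

  ⟦⟧-injective : ∀ {i j} → ⟦ i ⟧ ≡ ⟦ j ⟧ modulo + N → i ≡ j
  ⟦⟧-injective {i} {j} i≡j with ℕₚ.≤-total (toℕ i) (toℕ j)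
  ... | inj₁ i≤j = Finₚ.toℕ-injective (sym (ordered-injective i≤j (Finₚ.toℕ<n j) (≡mod-sym i≡j)))
  ... | inj₂ j≤i = Finₚ.toℕ-injective (ordered-injective j≤i (Finₚ.toℕ<n i) i≡j)

prime≥2 : ∀ {p} → Prime p → 2 ≤ p
prime≥2 {p} p-prime = ℕ.nonTrivial⇒n>1 p ⦃ prime⇒nonTrivial p-prime ⦄

prime∤⇒coprime : ∀ {p e} → Prime p → ¬ p ℕᵈ.∣ e → Coprime e p
prime∤⇒coprime {p} {e} p-prime p∤e {d} (d∣e , d∣p) with prime⇒irreducible p-prime d∣p
... | inj₁ d≡1 = d≡1
... | inj₂ refl = ⊥-elim (p∤e d∣e)

coprime-* : ∀ {a b c} → Coprime a b → Coprime a c → Coprime a (b ℕ.* c)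
coprime-* {a} {b} a⊥b a⊥c {d} (d∣a , d∣bc) = a⊥c (d∣a , coprime-divisor d⊥b d∣bc)
  where
    d⊥b : Coprime d b
    d⊥b (x∣d , x∣b) = a⊥b (ℕᵈ.∣-trans x∣d d∣a , x∣b)

coprime-^ : ∀ {a b} k → Coprime a b → Coprime a (b ^ k)
coprime-^ zero _ (_ , d∣1) = ℕᵈ.∣1⇒≡1 d∣1
coprime-^ (suc k) a⊥b = coprime-* a⊥b (coprime-^ k a⊥b)

bézout-combination : ∀ f x y r t → 1 ℕ.+ t ℕ.* y ≡ r ℕ.* x →
                     + r * + (f ℕ.* x) + - + t * + (f ℕ.* y) ≡ + f
bézout-combination f x y r t eq = begin
    + r * + (f ℕ.* x) + - + t * + (f ℕ.* y)
      ≡⟨ cong₂ (λ u v → + r * u + - + t * v) (ℤₚ.pos-* f x) (ℤₚ.pos-* f y) ⟩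
    + r * (+ f * + x) + - + t * (+ f * + y)   ≡⟨ factor (+ f) (+ x) (+ y) (+ r) (+ t) ⟩
    + f * (+ r * + x - + t * + y)             ≡⟨ cong (λ u → + f * (u - + t * + y)) eqℤ ⟨
    + f * (+ 1 + + t * + y - + t * + y)       ≡⟨ cancel (+ f) (+ t * + y) ⟩
    + f                                       ∎
  where
    open ≡-Reasoning
    eqℤ : + 1 + + t * + y ≡ + r * + x
    eqℤ = trans (sym (pos-+* 1 t y)) (trans (cong +_ eq) (ℤₚ.pos-* r x))
    factor : ∀ f x y r t → r * (f * x) + - t * (f * y) ≡ f * (r * x - t * y)
    factor = solve-∀
    cancel : ∀ f z → f * (+ 1 + z - z) ≡ f
    cancel = solve-∀

coprime-product-∣ : ∀ {a b z} → Coprime a b → a ℕᵈ.∣ z → b ℕᵈ.∣ z → a ℕ.* b ℕᵈ.∣ z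
coprime-product-∣ {a} {b} a⊥b (ℕᵈ.divides r z≡ra) b∣z
  with coprime-divisor (Coprime-sym a⊥b) (subst (b ℕᵈ.∣_) (trans z≡ra (ℕₚ.*-comm r a)) b∣z)
... | ℕᵈ.divides s r≡sb = ℕᵈ.divides s (begin
    _               ≡⟨ z≡ra ⟩
    r ℕ.* a         ≡⟨ cong (ℕ._* a) r≡sb ⟩
    s ℕ.* b ℕ.* a   ≡⟨ ℕₚ.*-assoc s b a ⟩
    s ℕ.* (b ℕ.* a) ≡⟨ cong (s ℕ.*_) (ℕₚ.*-comm b a) ⟩
    s ℕ.* (a ℕ.* b) ∎)
  where open ≡-Reasoning

halve-odd : ∀ {d} → Coprime d 2 → ∀ z → + d ∣ z * + 2 → + d ∣ z
halve-odd {d} d⊥2 z d∣2z =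
  ∣ᵤ⇒∣ (coprime-divisor d⊥2
    (subst (d ℕᵈ.∣_) (trans (ℤₚ.abs-* z (+ 2)) (ℕₚ.*-comm ℤ.∣ z ∣ 2)) (∣⇒∣ᵤ d∣2z)))

halve-4 : ∀ z → + 4 ∣ z * + 2 → + 2 ∣ z
halve-4 z 4∣2z = ∣ᵤ⇒∣ (ℕᵈ.*-cancelʳ-∣ 2 (subst (4 ℕᵈ.∣_) (ℤₚ.abs-* z (+ 2)) (∣⇒∣ᵤ 4∣2z)))

module _ {n : ℕ} where

  same-refl : ∀ {H : Sub n} → Same H H
  same-refl _ = refl

  same-sym : ∀ {H K : Sub n} → Same H K → Same K H
  same-sym H=K x = sym (H=K x)

  same-trans : ∀ {H K L : Sub n} → Same H K → Same K L → Same H L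
  same-trans H=K K=L x = trans (H=K x) (K=L x)

  InProd-resp : ∀ {H H′ K K′ : Sub n} {x} → Same H H′ → Same K K′ → InProd H K x → InProd H′ K′ x
  InProd-resp H=H′ K=K′ (y , k , y∈H , k∈K , yk≡x) =
    y , k , trans (sym (H=H′ y)) y∈H , trans (sym (K=K′ k)) k∈K , yk≡x

  permutable-respˡ : ∀ {H H′ K : Sub n} → Same H H′ → Permutable H K → Permutable H′ K
  permutable-respˡ H=H′ HK=KH x =
      (λ hk → InProd-resp same-refl H=H′ (proj₁ (HK=KH x) (InProd-resp (same-sym H=H′) same-refl hk)))
    , (λ kh → InProd-resp H=H′ same-refl (proj₂ (HK=KH x) (InProd-resp same-refl (same-sym H=H′) kh)))

  adj-sym : ∀ {H K : Sub n} → Adj H K → Adj K H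
  adj-sym (H≠K , HK=KH) = H≠K ∘ same-sym , λ x → proj₂ (HK=KH x) , proj₁ (HK=KH x)

module Cycle (M : ℕ) where

  open Residues M hiding (N)
  open Residues M public using (N)

  next-⟦⟧ : ∀ i → ⟦ next i ⟧ ≡ ⟦ i ⟧ + + 1 modulo + N
  next-⟦⟧ i = ≡mod-trans (⟦mod⟧ (suc (toℕ i)))
                         (≡mod-reflexive (trans (ℤₚ.pos-+ 1 (toℕ i)) (ℤₚ.+-comm (+ 1) ⟦ i ⟧)))

  walk : ℕ → Fin N → Fin N
  walk zero i = i
  walk (suc k) i = next (walk k i)

  walk-⟦⟧ : ∀ k i → ⟦ walk k i ⟧ ≡ ⟦ i ⟧ + + k modulo + N
  walk-⟦⟧ zero i = ≡mod-reflexive (sym (ℤₚ.+-identityʳ ⟦ i ⟧))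
  walk-⟦⟧ (suc k) i = begin
      ⟦ next (walk k i) ⟧      ≈⟨ next-⟦⟧ (walk k i) ⟩
      ⟦ walk k i ⟧ + + 1       ≈⟨ +-cong-mod (walk-⟦⟧ k i) (≡mod-refl {a = + 1}) ⟩
      ⟦ i ⟧ + + k + + 1        ≡⟨ ℤₚ.+-assoc ⟦ i ⟧ (+ k) (+ 1) ⟩
      ⟦ i ⟧ + (+ k + + 1)      ≡⟨ cong (λ z → ⟦ i ⟧ + z) (ℤₚ.pos-+ k 1) ⟨
      ⟦ i ⟧ + + (k ℕ.+ 1)      ≡⟨ cong (λ z → ⟦ i ⟧ + + z) (ℕₚ.+-comm k 1) ⟩
      ⟦ i ⟧ + + suc k          ∎
    where open ≡mod-Reasoning (+ N)

  prev : Fin N → Fin N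
  prev = walk M

  next-prev : ∀ i → next (prev i) ≡ i
  next-prev i = ⟦⟧-injective (≡mod-trans (walk-⟦⟧ N i) (+-modulus ⟦ i ⟧))

  next-injective : ∀ {i j} → next i ≡ next j → i ≡ j
  next-injective {i} {j} eq = ⟦⟧-injective (+-cancelˡ-mod (+ 1) (begin
      + 1 + ⟦ i ⟧    ≡⟨ ℤₚ.+-comm (+ 1) ⟦ i ⟧ ⟩
      ⟦ i ⟧ + + 1    ≈⟨ next-⟦⟧ i ⟨
      ⟦ next i ⟧     ≡⟨ cong ⟦_⟧ eq ⟩
      ⟦ next j ⟧     ≈⟨ next-⟦⟧ j ⟩
      ⟦ j ⟧ + + 1    ≡⟨ ℤₚ.+-comm ⟦ j ⟧ (+ 1) ⟩
      + 1 + ⟦ j ⟧    ∎))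
    where open ≡mod-Reasoning (+ N)

  next²≢id : 3 ≤ N → ∀ i → next (next i) ≢ i
  next²≢id 3≤N i eq = ≢0-small (s≤s z≤n) 3≤N (+-cancelˡ-mod ⟦ i ⟧ (begin
      ⟦ i ⟧ + + 2          ≈⟨ walk-⟦⟧ 2 i ⟨
      ⟦ walk 2 i ⟧         ≡⟨ cong ⟦_⟧ eq ⟩
      ⟦ i ⟧                ≡⟨ ℤₚ.+-identityʳ ⟦ i ⟧ ⟨
      ⟦ i ⟧ + + 0          ∎))
    where open ≡mod-Reasoning (+ N)

  prev-next : ∀ i → prev (next i) ≡ i
  prev-next i = next-injective (next-prev (next i))

  Neighbour : Fin N → Fin N → Set
  Neighbour j i = i ≡ prev j ⊎ i ≡ next j

  at-most-two-neighbours : ∀ {j a b c} → Neighbour j a → Neighbour j b → Neighbour j c → a ≡ b ⊎ a ≡ c ⊎ b ≡ c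
  at-most-two-neighbours (inj₁ a≡) (inj₁ b≡) _ = inj₁ (trans a≡ (sym b≡))
  at-most-two-neighbours (inj₂ a≡) (inj₂ b≡) _ = inj₁ (trans a≡ (sym b≡))
  at-most-two-neighbours (inj₁ a≡) (inj₂ _) (inj₁ c≡) = inj₂ (inj₁ (trans a≡ (sym c≡)))
  at-most-two-neighbours (inj₂ a≡) (inj₁ _) (inj₂ c≡) = inj₂ (inj₁ (trans a≡ (sym c≡)))
  at-most-two-neighbours (inj₁ _) (inj₂ b≡) (inj₂ c≡) = inj₂ (inj₂ (trans b≡ (sym c≡)))
  at-most-two-neighbours (inj₂ _) (inj₁ b≡) (inj₁ c≡) = inj₂ (inj₂ (trans b≡ (sym c≡)))

  propagate : (Q : Fin N → Set) → (∀ i → Q i → Q (next i)) → ∀ i j → Q i → Q j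
  propagate Q step i j Qi = subst Q arrive (along (toℕ j ℕ.+ (N ℕ.∸ toℕ i)))
    where
      along : ∀ k → Q (walk k i)
      along zero = Qi
      along (suc k) = step (walk k i) (along k)
      arrive : walk (toℕ j ℕ.+ (N ℕ.∸ toℕ i)) i ≡ j
      arrive = ⟦⟧-injective (begin
          ⟦ walk (toℕ j ℕ.+ (N ℕ.∸ toℕ i)) i ⟧    ≈⟨ walk-⟦⟧ (toℕ j ℕ.+ (N ℕ.∸ toℕ i)) i ⟩
          ⟦ i ⟧ + + (toℕ j ℕ.+ (N ℕ.∸ toℕ i))     ≡⟨ cong (λ z → ⟦ i ⟧ + z) (ℤₚ.pos-+ (toℕ j) (N ℕ.∸ toℕ i)) ⟩
          ⟦ i ⟧ + (⟦ j ⟧ + + (N ℕ.∸ toℕ i))       ≡⟨ cong (λ z → ⟦ i ⟧ + (⟦ j ⟧ + z)) (pos-∸ (ℕₚ.<⇒≤ (Finₚ.toℕ<n i))) ⟩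
          ⟦ i ⟧ + (⟦ j ⟧ + (+ N - ⟦ i ⟧))         ≡⟨ cancel ⟦ i ⟧ ⟦ j ⟧ (+ N) ⟩
          ⟦ j ⟧ + + N                              ≈⟨ +-modulus ⟦ j ⟧ ⟩
          ⟦ j ⟧                                    ∎)
        where
          open ≡mod-Reasoning (+ N)
          cancel : ∀ i j n → i + (j + (n - i)) ≡ j + n
          cancel = solve-∀

-- The dihedral group D_n (n = suc m ≥ 3) in exponent coordinates: every
-- element is a^z b^s = el z s for an integer z, determined modulo n, and
-- b^s acts on exponents by the sign sgn s.
module Dihedral (m : ℕ) (h : 3 ≤ suc m) where

  open Residues m public renaming (N to n)

  G : Set
  G = D n

  infix 4 _≋_
  _≋_ : ℤ → ℤ → Set
  a ≋ b = a ≡ b modulo + n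

  exponent : G → ℤ
  exponent (i , _) = ⟦ i ⟧

  reflects : G → Bool
  reflects (_ , s) = s

  -- b^s a^z = a^(sgn s · z) b^s
  sgn : Bool → ℤ
  sgn false = + 1
  sgn true = - + 1

  el : ℤ → Bool → G
  el z s = fromℕ< (ℤ÷.n%ℕd<d z n) , s

  el-exponent : ∀ z s → exponent (el z s) ≋ z
  el-exponent z s = ≡mod-sym (begin
      z                                   ≡⟨ ℤ÷.a≡a%ℕn+[a/ℕn]*n z n ⟩
      + (z ℤ.%ℕ n) + (z ℤ./ℕ n) * + n     ≈⟨ +-multiple _ (z ℤ./ℕ n) ⟩
      + (z ℤ.%ℕ n)                        ≡⟨ cong +_ (Finₚ.toℕ-fromℕ< (ℤ÷.n%ℕd<d z n)) ⟨
      exponent (el z s)                   ∎)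
    where open ≡mod-Reasoning (+ n)

  D-ext : ∀ {x y} → reflects x ≡ reflects y → exponent x ≋ exponent y → x ≡ y
  D-ext {i , s} {j , .s} refl i≡j = cong (_, s) (⟦⟧-injective i≡j)

  el-η : ∀ x → el (exponent x) (reflects x) ≡ x
  el-η x = D-ext refl (el-exponent (exponent x) (reflects x))

  el-cong : ∀ {a b} s → a ≋ b → el a s ≡ el b s
  el-cong {a} {b} s a≡b =
    D-ext refl (≡mod-trans (el-exponent a s) (≡mod-trans a≡b (≡mod-sym (el-exponent b s))))

  el-injective : ∀ {a b s} → el a s ≡ el b s → a ≋ b
  el-injective {a} {b} {s} eq =
    ≡mod-trans (≡mod-sym (el-exponent a s)) (≡mod-trans (≡mod-reflexive (cong exponent eq)) (el-exponent b s))

  mul-exponent : ∀ x y → exponent (mul x y) ≋ exponent x + sgn (reflects x) * exponent y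
  mul-exponent (i , false) (j , t) = begin
      ⟦ (toℕ i ℕ.+ toℕ j) mod n ⟧    ≈⟨ ⟦mod⟧ (toℕ i ℕ.+ toℕ j) ⟩
      + (toℕ i ℕ.+ toℕ j)           ≡⟨ ℤₚ.pos-+ (toℕ i) (toℕ j) ⟩
      ⟦ i ⟧ + ⟦ j ⟧                  ≡⟨ cong (_+_ ⟦ i ⟧) (ℤₚ.*-identityˡ ⟦ j ⟧) ⟨
      ⟦ i ⟧ + + 1 * ⟦ j ⟧            ∎
    where open ≡mod-Reasoning (+ n)
  mul-exponent (i , true) (j , t) = begin
      ⟦ (toℕ i ℕ.+ (n ℕ.∸ toℕ j)) mod n ⟧   ≈⟨ ⟦mod⟧ (toℕ i ℕ.+ (n ℕ.∸ toℕ j)) ⟩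
      + (toℕ i ℕ.+ (n ℕ.∸ toℕ j))           ≡⟨ ℤₚ.pos-+ (toℕ i) (n ℕ.∸ toℕ j) ⟩
      ⟦ i ⟧ + + (n ℕ.∸ toℕ j)               ≡⟨ cong (_+_ ⟦ i ⟧) (pos-∸ (ℕₚ.<⇒≤ (Finₚ.toℕ<n j))) ⟩
      ⟦ i ⟧ + (+ n - ⟦ j ⟧)                 ≡⟨ reflect-form ⟦ i ⟧ ⟦ j ⟧ (+ n) ⟩
      (⟦ i ⟧ + - + 1 * ⟦ j ⟧) + + 1 * + n   ≈⟨ +-multiple _ (+ 1) ⟩
      ⟦ i ⟧ + - + 1 * ⟦ j ⟧                 ∎
    where
      open ≡mod-Reasoning (+ n)
      reflect-form : ∀ a b n → a + (n - b) ≡ (a + - + 1 * b) + + 1 * n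
      reflect-form = solve-∀

  mul-el : ∀ a s b t → mul (el a s) (el b t) ≡ el (a + sgn s * b) (s xor t)
  mul-el a s b t = D-ext refl (begin
      exponent (mul (el a s) (el b t))                ≈⟨ mul-exponent (el a s) (el b t) ⟩
      exponent (el a s) + sgn s * exponent (el b t)   ≈⟨ +-cong-mod (el-exponent a s)
                                                            (*-congˡ-mod (sgn s) (el-exponent b t)) ⟩
      a + sgn s * b                                   ≈⟨ el-exponent (a + sgn s * b) (s xor t) ⟨
      exponent (el (a + sgn s * b) (s xor t))         ∎)
    where open ≡mod-Reasoning (+ n)

  inv-rotation : ∀ a → inv (el a false) ≡ el (- a) false
  inv-rotation a = D-ext refl (begin
      ⟦ (n ℕ.∸ toℕ i) mod n ⟧    ≈⟨ ⟦mod⟧ (n ℕ.∸ toℕ i) ⟩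
      + (n ℕ.∸ toℕ i)            ≡⟨ pos-∸ (ℕₚ.<⇒≤ (Finₚ.toℕ<n i)) ⟩
      + n - ⟦ i ⟧                ≡⟨ neg-form ⟦ i ⟧ (+ n) ⟩
      - ⟦ i ⟧ + + 1 * + n        ≈⟨ +-multiple (- ⟦ i ⟧) (+ 1) ⟩
      - ⟦ i ⟧                    ≈⟨ -‿cong-mod (el-exponent a false) ⟩
      - a                        ≈⟨ el-exponent (- a) false ⟨
      exponent (el (- a) false)  ∎)
    where
      open ≡mod-Reasoning (+ n)
      i = proj₁ (el a false)
      neg-form : ∀ x n → n - x ≡ - x + + 1 * n
      neg-form = solve-∀

  inv-reflection : ∀ a → inv (el a true) ≡ el a true
  inv-reflection a = refl

  one-el : one h ≡ el (+ 0) false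
  one-el = D-ext refl (≡mod-trans (⟦mod⟧ 0) (≡mod-sym (el-exponent (+ 0) false)))

  -- sgn is a homomorphism, which makes mul associative
  sgn-xor : ∀ s t → sgn (s xor t) ≡ sgn s * sgn t
  sgn-xor false false = refl
  sgn-xor false true = refl
  sgn-xor true false = refl
  sgn-xor true true = refl

  assoc : ∀ x y z → mul (mul x y) z ≡ mul x (mul y z)
  assoc x@(i , s) y@(j , t) z@(k , u) = D-ext (xor-assoc s t u) (begin
      exponent (mul (mul x y) z)                         ≈⟨ mul-exponent (mul x y) z ⟩
      exponent (mul x y) + sgn (s xor t) * ⟦ k ⟧         ≈⟨ +-cong-mod (mul-exponent x y) (≡mod-refl {a = sgn (s xor t) * ⟦ k ⟧}) ⟩
      (⟦ i ⟧ + sgn s * ⟦ j ⟧) + sgn (s xor t) * ⟦ k ⟧    ≡⟨ cong (λ σ → (⟦ i ⟧ + sgn s * ⟦ j ⟧) + σ * ⟦ k ⟧) (sgn-xor s t) ⟩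
      (⟦ i ⟧ + sgn s * ⟦ j ⟧) + (sgn s * sgn t) * ⟦ k ⟧  ≡⟨ regroup ⟦ i ⟧ ⟦ j ⟧ ⟦ k ⟧ (sgn s) (sgn t) ⟩
      ⟦ i ⟧ + sgn s * (⟦ j ⟧ + sgn t * ⟦ k ⟧)            ≈⟨ +-cong-mod (≡mod-refl {a = ⟦ i ⟧}) (*-congˡ-mod (sgn s) (mul-exponent y z)) ⟨
      ⟦ i ⟧ + sgn s * exponent (mul y z)                 ≈⟨ mul-exponent x (mul y z) ⟨
      exponent (mul x (mul y z))                         ∎)
    where
      open ≡mod-Reasoning (+ n)
      regroup : ∀ x y z σ τ → (x + σ * y) + (σ * τ) * z ≡ x + σ * (y + τ * z)
      regroup = solve-∀

  conj-rot-rot : ∀ a e → mul (mul (el a false) (el e false)) (inv (el a false)) ≡ el e false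
  conj-rot-rot a e = begin
      mul (mul (el a false) (el e false)) (inv (el a false))  ≡⟨ cong₂ mul (mul-el a false e false) (inv-rotation a) ⟩
      mul (el (a + + 1 * e) false) (el (- a) false)           ≡⟨ mul-el (a + + 1 * e) false (- a) false ⟩
      el ((a + + 1 * e) + + 1 * - a) false                    ≡⟨ cong (λ z → el z false) (exponents a e) ⟩
      el e false                                              ∎
    where
      open ≡-Reasoning
      exponents : ∀ a e → (a + + 1 * e) + + 1 * - a ≡ e
      exponents = solve-∀

  conj-rot-ref : ∀ a e → mul (mul (el a false) (el e true)) (inv (el a false)) ≡ el (a * + 2 + e) true
  conj-rot-ref a e = begin
      mul (mul (el a false) (el e true)) (inv (el a false))   ≡⟨ cong₂ mul (mul-el a false e true) (inv-rotation a) ⟩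
      mul (el (a + + 1 * e) true) (el (- a) false)            ≡⟨ mul-el (a + + 1 * e) true (- a) false ⟩
      el ((a + + 1 * e) + - + 1 * - a) true                   ≡⟨ cong (λ z → el z true) (exponents a e) ⟩
      el (a * + 2 + e) true                                   ∎
    where
      open ≡-Reasoning
      exponents : ∀ a e → (a + + 1 * e) + - + 1 * - a ≡ a * + 2 + e
      exponents = solve-∀

  conj-ref-rot : ∀ a e → mul (mul (el a true) (el e false)) (inv (el a true)) ≡ el (- e) false
  conj-ref-rot a e = begin
      mul (mul (el a true) (el e false)) (inv (el a true))    ≡⟨ cong₂ mul (mul-el a true e false) (inv-reflection a) ⟩
      mul (el (a + - + 1 * e) true) (el a true)               ≡⟨ mul-el (a + - + 1 * e) true a true ⟩
      el ((a + - + 1 * e) + - + 1 * a) false                  ≡⟨ cong (λ z → el z false) (exponents a e) ⟩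
      el (- e) false                                          ∎
    where
      open ≡-Reasoning
      exponents : ∀ a e → (a + - + 1 * e) + - + 1 * a ≡ - e
      exponents = solve-∀

  conj-ref-ref : ∀ a e → mul (mul (el a true) (el e true)) (inv (el a true)) ≡ el ((a - e) * + 2 + e) true
  conj-ref-ref a e = begin
      mul (mul (el a true) (el e true)) (inv (el a true))     ≡⟨ cong₂ mul (mul-el a true e true) (inv-reflection a) ⟩
      mul (el (a + - + 1 * e) false) (el a true)              ≡⟨ mul-el (a + - + 1 * e) false a true ⟩
      el ((a + - + 1 * e) + + 1 * a) true                     ≡⟨ cong (λ z → el z true) (exponents a e) ⟩
      el ((a - e) * + 2 + e) true                             ∎
    where
      open ≡-Reasoning
      exponents : ∀ a e → (a + - + 1 * e) + + 1 * a ≡ (a - e) * + 2 + e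
      exponents = solve-∀

  -- S contains a^z b^s; a record so that z and s stay inferable
  record Contains (S : Sub n) (z : ℤ) (s : Bool) : Set where
    constructor contains
    field member : el z s ∈ S
  open Contains public

  Rot : Sub n → ℤ → Set
  Rot S z = Contains S z false

  Ref : Sub n → ℤ → Set
  Ref S u = Contains S u true

  RotationsIn : ℤ → Sub n → Set
  RotationsIn d S = ∀ z → Rot S z → d ∣ z

  module Subgroup (S : Sub n) (sub : IsSubgroup h S) where

    contains-cong : ∀ {a b s} → a ≋ b → Contains S a s → Contains S b s
    contains-cong {s = s} a≡b (contains a∈S) = contains (subst (_∈ S) (el-cong s a≡b) a∈S)

    contains-≡ : ∀ {a b s} → Contains S a s → a ≡ b → Contains S b s
    contains-≡ a∈S refl = a∈S

    contains-η : ∀ {x} → x ∈ S → Contains S (exponent x) (reflects x)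
    contains-η {x} x∈S = contains (subst (_∈ S) (sym (el-η x)) x∈S)

    member-η : ∀ {x} → Contains S (exponent x) (reflects x) → x ∈ S
    member-η {x} (contains x∈S) = subst (_∈ S) (el-η x) x∈S

    closed : ∀ {a s b t} → Contains S a s → Contains S b t → Contains S (a + sgn s * b) (s xor t)
    closed {a} {s} {b} {t} (contains a∈S) (contains b∈S) =
      contains (subst (_∈ S) (mul-el a s b t) (proj₁ (proj₂ sub) _ _ a∈S b∈S))

    rot-zero : Rot S (+ 0)
    rot-zero = contains (subst (_∈ S) one-el (proj₁ sub))

    rot-n : Rot S (+ n)
    rot-n = contains-cong (≡mod-sym (∣⇒≡0 ∣-refl)) rot-zero

    rot-neg : ∀ {a} → Rot S a → Rot S (- a)
    rot-neg {a} (contains a∈S) =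
      contains (subst (_∈ S) (inv-rotation a) (proj₂ (proj₂ sub) _ a∈S))

    rot+rot : ∀ {a b} → Rot S a → Rot S b → Rot S (a + b)
    rot+rot {a} {b} a∈S b∈S = contains-≡ (closed a∈S b∈S) (solve (a ∷ b ∷ []))

    rot+ref : ∀ {a b} → Rot S a → Ref S b → Ref S (a + b)
    rot+ref {a} {b} a∈S b∈S = contains-≡ (closed a∈S b∈S) (solve (a ∷ b ∷ []))

    ref-ref : ∀ {a b} → Ref S a → Ref S b → Rot S (a - b)
    ref-ref {a} {b} a∈S b∈S = contains-≡ (closed a∈S b∈S) (solve (a ∷ b ∷ []))

    rot-ℕ-multiple : ∀ {a} → Rot S a → ∀ k → Rot S (+ k * a)
    rot-ℕ-multiple {a} a∈S zero = contains-≡ rot-zero (sym (ℤₚ.*-zeroˡ a))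
    rot-ℕ-multiple {a} a∈S (suc k) =
      contains-≡ (rot+rot a∈S (rot-ℕ-multiple a∈S k)) (sym (ℤₚ.suc-* (+ k) a))

    rot-multiple : ∀ {a} → Rot S a → ∀ k → Rot S (k * a)
    rot-multiple a∈S (+ k) = rot-ℕ-multiple a∈S k
    rot-multiple {a} a∈S ℤ.-[1+ k ] =
      contains-≡ (rot-neg (rot-ℕ-multiple a∈S (suc k))) (ℤₚ.neg-distribˡ-* (+ suc k) a)

    rot-gcd : ∀ {f x y} → Rot S (+ (f ℕ.* x)) → Rot S (+ (f ℕ.* y)) → Coprime x y → Rot S (+ f)
    rot-gcd {f} {x} {y} fx∈S fy∈S x⊥y with coprime-Bézout x⊥y
    ... | Bézout.+- r t eq =
      contains-≡ (rot+rot (rot-multiple fx∈S (+ r)) (rot-multiple fy∈S (- + t))) (bézout-combination f x y r t eq)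
    ... | Bézout.-+ r t eq =
      contains-≡ (rot+rot (rot-multiple fy∈S (+ t)) (rot-multiple fx∈S (- + r))) (bézout-combination f y x t r eq)

    rot-divisible : ∀ {d z} → Rot S d → d ∣ z → Rot S z
    rot-divisible d∈S (divides k z≡kd) = contains-≡ (rot-multiple d∈S k) (sym z≡kd)

    rot-coprime : ∀ {x y} → Rot S (+ x) → Rot S (+ y) → Coprime x y → Rot S (+ 1)
    rot-coprime {x} {y} x∈S y∈S =
      rot-gcd (contains-≡ x∈S (cong +_ (sym (ℕₚ.*-identityˡ x)))) (contains-≡ y∈S (cong +_ (sym (ℕₚ.*-identityˡ y))))

    cofactor-rotation : ∀ {r t e} → Prime t → n ≡ r ℕ.* t →
                        Rot S (+ e) → r ℕᵈ.∣ e → ¬ t ℕᵈ.∣ e → Rot S (+ r)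
    cofactor-rotation {r} {t} {e} t-prime n≡rt e∈S (ℕᵈ.divides x e≡xr) t∤e =
      rot-gcd {r} {x} {t} (contains-≡ e∈S (cong +_ (trans e≡xr (ℕₚ.*-comm x r)))) (subst (λ k → Rot S (+ k)) n≡rt rot-n)
              (prime∤⇒coprime t-prime λ t∣x →
                 t∤e (subst (t ℕᵈ.∣_) (sym e≡xr) (ℕᵈ.∣-trans t∣x (ℕᵈ.m∣m*n r))))

    rot-ℕ-scale : ∀ {e} → Rot S (+ e) → ∀ k → Rot S (+ (k ℕ.* e))
    rot-ℕ-scale {e} e∈S k = contains-≡ (rot-multiple e∈S (+ k)) (sym (ℤₚ.pos-* k e))

    rot-abs : ∀ {z} → Rot S z → Rot S (+ ℤ.∣ z ∣)
    rot-abs {z} z∈S with ℤₚ.+∣i∣≡i⊎+∣i∣≡-i z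
    ... | inj₁ ∣z∣≡z = contains-≡ z∈S (sym ∣z∣≡z)
    ... | inj₂ ∣z∣≡-z = contains-≡ (rot-neg z∈S) (sym ∣z∣≡-z)

    rotations-from-ℕ : ∀ {d} → (∀ e → Rot S (+ e) → d ℕᵈ.∣ e) → RotationsIn (+ d) S
    rotations-from-ℕ d∣ z z∈S = ∣ᵤ⇒∣ (d∣ ℤ.∣ z ∣ (rot-abs z∈S))

    ConjugationClosed : Set
    ConjugationClosed = ∀ a s e t → el e t ∈ S → mul (mul (el a s) (el e t)) (inv (el a s)) ∈ S

    normal-by-exponents : ConjugationClosed → Normal S
    normal-by-exponents conj∈S g x x∈S =
      subst₂ (λ g x → mul (mul g x) (inv g) ∈ S) (el-η g) (el-η x)
        (conj∈S (exponent g) (reflects g) (exponent x) (reflects x) (subst (_∈ S) (sym (el-η x)) x∈S))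

    conj-rotation : ∀ a s e → el e false ∈ S → mul (mul (el a s) (el e false)) (inv (el a s)) ∈ S
    conj-rotation a false e e∈S = subst (_∈ S) (sym (conj-rot-rot a e)) e∈S
    conj-rotation a true e e∈S = subst (_∈ S) (sym (conj-ref-rot a e)) (member (rot-neg (contains {z = e} e∈S)))

    rotations-normal : (∀ u → ¬ Ref S u) → Normal S
    rotations-normal no-ref = normal-by-exponents conj∈S
      where
        conj∈S : ConjugationClosed
        conj∈S a s e false e∈S = conj-rotation a s e e∈S
        conj∈S a s e true e∈S = ⊥-elim (no-ref e (contains e∈S))

    -- a subgroup containing a² is normal: conjugates of a^e b are a^(2k + e) b
    a²-normal : Rot S (+ 2) → Normal S
    a²-normal a²∈S = normal-by-exponents conj∈S
      where
        conj∈S : ConjugationClosed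
        conj∈S a s e false e∈S = conj-rotation a s e e∈S
        conj∈S a false e true e∈S =
          subst (_∈ S) (sym (conj-rot-ref a e)) (member (rot+ref (rot-multiple a²∈S a) (contains {z = e} e∈S)))
        conj∈S a true e true e∈S =
          subst (_∈ S) (sym (conj-ref-ref a e)) (member (rot+ref (rot-multiple a²∈S (a - e)) (contains {z = e} e∈S)))

  module Vertex-facts {S : Sub n} (vertex : Vertex h S) where

    open Subgroup S (proj₁ vertex)

    private
      non-normal : ¬ Normal S
      non-normal = proj₂ (proj₂ vertex)

    vertex-reflection : ∃ λ u → Ref S u
    vertex-reflection with Finₚ.any? (λ i → S (i , true) Boolₚ.≟ true)
    ... | yes (i , i∈S) = ⟦ i ⟧ , contains-η i∈S
    ... | no no-i = ⊥-elim (non-normal (rotations-normal λ u u∈S → no-i (proj₁ (el u true) , member u∈S)))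

    vertex-∌a² : ¬ Rot S (+ 2)
    vertex-∌a² a²∈S = non-normal (a²-normal a²∈S)

    vertex-∌a : ¬ Rot S (+ 1)
    vertex-∌a a∈S = vertex-∌a² (rot+rot a∈S a∈S)

  product-closed : ∀ {H K} → IsSubgroup h H → IsSubgroup h K → Permutable H K →
                   ∀ {x y} → InProd H K x → InProd H K y → InProd H K (mul x y)
  product-closed {H} {K} subH subK HK=KH (h₁ , k₁ , h₁∈H , k₁∈K , refl) (h₂ , k₂ , h₂∈H , k₂∈K , refl)
    with proj₂ (HK=KH (mul k₁ h₂)) (k₁ , h₂ , k₁∈K , h₂∈H , refl)
  ... | h₃ , k₃ , h₃∈H , k₃∈K , h₃k₃≡k₁h₂ =
    mul h₁ h₃ , mul k₃ k₂ , proj₁ (proj₂ subH) _ _ h₁∈H h₃∈H , proj₁ (proj₂ subK) _ _ k₃∈K k₂∈K , regroup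
    where
      open ≡-Reasoning
      regroup : mul (mul h₁ h₃) (mul k₃ k₂) ≡ mul (mul h₁ k₁) (mul h₂ k₂)
      regroup = begin
        mul (mul h₁ h₃) (mul k₃ k₂)  ≡⟨ assoc h₁ h₃ (mul k₃ k₂) ⟩
        mul h₁ (mul h₃ (mul k₃ k₂))  ≡⟨ cong (mul h₁) (assoc h₃ k₃ k₂) ⟨
        mul h₁ (mul (mul h₃ k₃) k₂)  ≡⟨ cong (λ z → mul h₁ (mul z k₂)) h₃k₃≡k₁h₂ ⟩
        mul h₁ (mul (mul k₁ h₂) k₂)  ≡⟨ cong (mul h₁) (assoc k₁ h₂ k₂) ⟩
        mul h₁ (mul k₁ (mul h₂ k₂))  ≡⟨ assoc h₁ k₁ (mul h₂ k₂) ⟨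
        mul (mul h₁ k₁) (mul h₂ k₂)  ∎

  reflection-product : ∀ u v → mul (el u true) (el v true) ≡ el (u - v) false
  reflection-product u v = trans (mul-el u true v true) (cong (λ z → el z false) (difference-form u v))
    where
      difference-form : ∀ u v → u + - + 1 * v ≡ u - v
      difference-form = solve-∀

  -- Then d ∣ 2(u − v): the square a^(2(u−v)) of
  -- (a^u b)(a^v b) ∈ HK is a product h k, and both cases (h, k rotations, or
  -- both reflections) force the claim.
  module _ {H K : Sub n} (subH : IsSubgroup h H) (subK : IsSubgroup h K) (HK=KH : Permutable H K)
           {d : ℤ} (d∣n : d ∣ + n) (rotsH : RotationsIn d H) (rotsK : RotationsIn d K)
           {u v : ℤ} (u∈H : Ref H u) (v∈K : Ref K v) where

    private
      module H = Subgroup H subH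
      module K = Subgroup K subK

      rotations-case : ∀ a b u v → (a + b) - ((a + + 1 * b) - (u - v) * + 2) ≡ (u - v) * + 2
      rotations-case = solve-∀

      reflections-case : ∀ a b u v → ((a - u) - (b - v)) - ((a + - + 1 * b) - (u - v) * + 2) ≡ u - v
      reflections-case = solve-∀

      from-factors : ∀ {a s b t} → Contains H a s → Contains K b t → s xor t ≡ false →
                     a + sgn s * b ≋ (u - v) * + 2 → d ∣ (u - v) * + 2
      from-factors {a} {false} {b} {false} a∈H b∈K _ ab≡ = subst (d ∣_) (rotations-case a b u v) d∣
        where
          d∣a+b : d ∣ a + b
          d∣a+b = ∣m∣n⇒∣m+n (rotsH a a∈H) (rotsK b b∈K)
          d∣ab- : d ∣ (a + + 1 * b) - (u - v) * + 2
          d∣ab- = difference (≡mod-divisor d∣n ab≡)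
          d∣ : d ∣ (a + b) - ((a + + 1 * b) - (u - v) * + 2)
          d∣ = ∣m∣n⇒∣m-n d∣a+b d∣ab-
      from-factors {a} {true} {b} {true} a∈H b∈K _ ab≡ =
        ∣m⇒∣m*n (+ 2) (subst (d ∣_) (reflections-case a b u v) d∣)
        where
          d∣a-u : d ∣ a - u
          d∣a-u = rotsH (a - u) (H.ref-ref a∈H u∈H)
          d∣b-v : d ∣ b - v
          d∣b-v = rotsK (b - v) (K.ref-ref b∈K v∈K)
          d∣ab- : d ∣ (a + - + 1 * b) - (u - v) * + 2
          d∣ab- = difference (≡mod-divisor d∣n ab≡)
          d∣ : d ∣ ((a - u) - (b - v)) - ((a + - + 1 * b) - (u - v) * + 2)
          d∣ = ∣m∣n⇒∣m-n (∣m∣n⇒∣m-n d∣a-u d∣b-v) d∣ab-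
      from-factors {s = false} {t = true} _ _ ()
      from-factors {s = true} {t = false} _ _ ()

      x∈HK : InProd H K (mul (el u true) (el v true))
      x∈HK = el u true , el v true , member u∈H , member v∈K , refl

      x²≡ : mul (mul (el u true) (el v true)) (mul (el u true) (el v true)) ≡ el ((u - v) + + 1 * (u - v)) false
      x²≡ = trans (cong (λ x → mul x x) (reflection-product u v)) (mul-el (u - v) false (u - v) false)

      x²∈HK : InProd H K (el ((u - v) + + 1 * (u - v)) false)
      x²∈HK = subst (InProd H K) x²≡ (product-closed subH subK HK=KH x∈HK x∈HK)

      from-decomposition : ∀ {w} → InProd H K (el w false) → w ≋ (u - v) * + 2 → d ∣ (u - v) * + 2
      from-decomposition {w} (y , k , y∈H , k∈K , yk≡w) w≡ =
        from-factors (H.contains-η y∈H) (K.contains-η k∈K) (cong reflects yk≡w) (begin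
          exponent y + sgn (reflects y) * exponent k  ≈⟨ mul-exponent y k ⟨
          exponent (mul y k)                          ≡⟨ cong exponent yk≡w ⟩
          exponent (el w false)                       ≈⟨ el-exponent w false ⟩
          w                                           ≈⟨ w≡ ⟩
          (u - v) * + 2                               ∎)
        where open ≡mod-Reasoning (+ n)

    permutable-reflections : d ∣ (u - v) * + 2
    permutable-reflections = from-decomposition x²∈HK (≡mod-reflexive (double (u - v)))
      where
        double : ∀ z → z + + 1 * z ≡ z * + 2
        double = solve-∀

  rotation≢reflection : ∀ {a b} → el a false ≢ el b true
  rotation≢reflection ()

  ε : G
  ε = el (+ 0) false

  _≟G_ : (x y : G) → Dec (x ≡ y)
  _≟G_ = ≡-dec Finₚ._≟_ Boolₚ._≟_

  ⟨a^_b⟩ : ℤ → Sub n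
  ⟨a^ u b⟩ x = ⌊ x ≟G ε ⌋ ∨ ⌊ x ≟G el u true ⌋

  module _ (u : ℤ) where

    ⟨a^b⟩-elim : ∀ x → x ∈ ⟨a^ u b⟩ → x ≡ ε ⊎ x ≡ el u true
    ⟨a^b⟩-elim x x∈ with x ≟G ε | x ≟G el u true
    ... | yes x≡e | _ = inj₁ x≡e
    ... | no _ | yes x≡r = inj₂ x≡r

    ⟨a^b⟩-intro : ∀ x → x ≡ ε ⊎ x ≡ el u true → x ∈ ⟨a^ u b⟩
    ⟨a^b⟩-intro x x≡ with x ≟G ε | x ≟G el u true
    ... | yes _ | _ = refl
    ... | no _ | yes _ = refl
    ... | no x≢e | no x≢r = ⊥-elim ([ x≢e , x≢r ]′ x≡)

    ⟨a^b⟩-subgroup : IsSubgroup h ⟨a^ u b⟩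
    ⟨a^b⟩-subgroup = ⟨a^b⟩-intro (one h) (inj₁ one-el) , mul-closed , inv-closed
      where
        product : ∀ {x y} → x ≡ ε ⊎ x ≡ el u true → y ≡ ε ⊎ y ≡ el u true → mul x y ≡ ε ⊎ mul x y ≡ el u true
        product (inj₁ refl) (inj₁ refl) = inj₁ (mul-el (+ 0) false (+ 0) false)
        product (inj₁ refl) (inj₂ refl) = inj₂ (trans (mul-el (+ 0) false u true) (cong (λ z → el z true) (left-unit u)))
          where left-unit : ∀ u → + 0 + + 1 * u ≡ u
                left-unit = solve-∀
        product (inj₂ refl) (inj₁ refl) = inj₂ (trans (mul-el u true (+ 0) false) (cong (λ z → el z true) (ℤₚ.+-identityʳ u)))
        product (inj₂ refl) (inj₂ refl) = inj₁ (trans (mul-el u true u true) (cong (λ z → el z false) (cancel u)))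
          where cancel : ∀ u → u + - + 1 * u ≡ + 0
                cancel = solve-∀
        mul-closed : ∀ x y → x ∈ ⟨a^ u b⟩ → y ∈ ⟨a^ u b⟩ → mul x y ∈ ⟨a^ u b⟩
        mul-closed x y x∈ y∈ = ⟨a^b⟩-intro (mul x y) (product (⟨a^b⟩-elim x x∈) (⟨a^b⟩-elim y y∈))
        inverse : ∀ {x} → x ≡ ε ⊎ x ≡ el u true → inv x ≡ ε ⊎ inv x ≡ el u true
        inverse (inj₁ refl) = inj₁ (inv-rotation (+ 0))
        inverse (inj₂ refl) = inj₂ (inv-reflection u)
        inv-closed : ∀ x → x ∈ ⟨a^ u b⟩ → inv x ∈ ⟨a^ u b⟩
        inv-closed x x∈ = ⟨a^b⟩-intro (inv x) (inverse (⟨a^b⟩-elim x x∈))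

    ⟨a^b⟩-rotations : RotationsIn (+ n) ⟨a^ u b⟩
    ⟨a^b⟩-rotations z (contains z∈) = rotation-case (⟨a^b⟩-elim (el z false) z∈)
      where
        rotation-case : el z false ≡ ε ⊎ el z false ≡ el u true → + n ∣ z
        rotation-case (inj₁ z≡e) = ≡0⇒∣ (el-injective {z} {+ 0} z≡e)
        rotation-case (inj₂ z≡r) = ⊥-elim (rotation≢reflection {z} {u} z≡r)

    ⟨a^b⟩-generator : Ref ⟨a^ u b⟩ u
    ⟨a^b⟩-generator = contains (⟨a^b⟩-intro (el u true) (inj₂ refl))

    ⟨a^b⟩-reflection : ∀ x → el x true ∈ ⟨a^ u b⟩ → x ≋ u
    ⟨a^b⟩-reflection x x∈ = [ (λ x≡e → ⊥-elim (rotation≢reflection {+ 0} {x} (sym x≡e))) , el-injective {x} {u} ]′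
                              (⟨a^b⟩-elim (el x true) x∈)

    -- it is a vertex: a ∉ ⟨a^u b⟩, and a (a^u b) a⁻¹ = a^(u+2) b ∉ ⟨a^u b⟩
    ⟨a^b⟩-vertex : Vertex h ⟨a^ u b⟩
    ⟨a^b⟩-vertex = ⟨a^b⟩-subgroup , (el (+ 1) false , a∉) , non-normal
      where
        a∉ : ¬ (el (+ 1) false ∈ ⟨a^ u b⟩)
        a∉ a∈ = [ a≢e , rotation≢reflection {+ 1} {u} ]′ (⟨a^b⟩-elim (el (+ 1) false) a∈)
          where
            a≢e : el (+ 1) false ≢ ε
            a≢e a≡e = ≢0-small (s≤s z≤n) (ℕₚ.<-trans (s≤s (s≤s z≤n)) h) (el-injective {+ 1} {+ 0} a≡e)
        non-normal : ¬ Normal ⟨a^ u b⟩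
        non-normal normal = [ rotation≢reflection {+ 0} {+ 1 * + 2 + u} ∘ sym , r′≢r ]′ (⟨a^b⟩-elim r′ r′∈)
          where
            r′ : G
            r′ = el (+ 1 * + 2 + u) true
            r′∈ : r′ ∈ ⟨a^ u b⟩
            r′∈ = subst (_∈ ⟨a^ u b⟩) (conj-rot-ref (+ 1) u)
                    (normal (el (+ 1) false) (el u true) (⟨a^b⟩-intro (el u true) (inj₂ refl)))
            shift : ∀ u → (+ 1 * + 2 + u) - u ≡ + 2
            shift = solve-∀
            r′≢r : r′ ≢ el u true
            r′≢r r′≡r = ≢0-small (s≤s z≤n) h
              (∣⇒≡0 (subst (+ n ∣_) (shift u) (difference (el-injective {+ 1 * + 2 + u} {u} r′≡r))))

  ⟨a^b⟩-injective : ∀ {u w} → Same ⟨a^ u b⟩ ⟨a^ w b⟩ → u ≋ w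
  ⟨a^b⟩-injective {u} {w} same =
    ⟨a^b⟩-reflection w u (trans (sym (same (el u true))) (member (⟨a^b⟩-generator u)))

  -- Rotations of a vertex for the three "invariant" shapes of n: a
  -- rotation a^e outside the claimed subgroup would, via Bézout, put a or
  -- a² into the vertex.
  module Vertex-rotations {S : Sub n} (vertex : Vertex h S) where

    open Subgroup S (proj₁ vertex)
    open Vertex-facts vertex

    coprime-rotation-absent : ∀ {e} → Rot S (+ e) → ¬ Coprime e n
    coprime-rotation-absent e∈S e⊥n = vertex-∌a (rot-coprime e∈S rot-n e⊥n)

    -- a^r ∈ S for a prime r: all rotations lie in rℤ (a^e with r ∤ e would give a)
    prime-rotations : ∀ {r} → Prime r → Rot S (+ r) → RotationsIn (+ r) S
    prime-rotations {r} r-prime r∈S = rotations-from-ℕ λ e e∈S →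
      decidable-stable (r ℕᵈ.∣? e) λ r∤e → vertex-∌a (rot-coprime r∈S e∈S (Coprime-sym (prime∤⇒coprime r-prime r∤e)))

    prime-power-rotations : ∀ {p α} → Prime p → n ≡ p ^ α → RotationsIn (+ p) S
    prime-power-rotations {p} {α} p-prime n≡pᵅ = rotations-from-ℕ λ e e∈S →
      decidable-stable (p ℕᵈ.∣? e) λ p∤e →
        coprime-rotation-absent e∈S (subst (Coprime e) (sym n≡pᵅ) (coprime-^ α (prime∤⇒coprime p-prime p∤e)))

    twice-prime-rotations : ∀ {p} → Prime p → n ≡ 2 ℕ.* p → RotationsIn (+ p) S
    twice-prime-rotations {p} p-prime n≡2p = rotations-from-ℕ λ e e∈S →
      decidable-stable (p ℕᵈ.∣? e) λ p∤e →
        vertex-∌a² (rot-gcd {2} {e} {p} (rot-ℕ-scale e∈S 2) (subst (λ k → Rot S (+ k)) n≡2p rot-n)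
                                        (prime∤⇒coprime p-prime p∤e))

    power-of-two-rotations : ∀ {α} → n ≡ 2 ^ suc α → RotationsIn (+ 4) S
    power-of-two-rotations {α} n≡2ᵅ⁺¹ = rotations-from-ℕ λ e e∈S →
      decidable-stable (4 ℕᵈ.∣? e) λ 4∤e → rotation-case e∈S 4∤e (2 ℕᵈ.∣? e)
      where
        rotation-case : ∀ {e} → Rot S (+ e) → ¬ 4 ℕᵈ.∣ e → Dec (2 ℕᵈ.∣ e) → ⊥
        rotation-case e∈S _ (no 2∤e) =
          coprime-rotation-absent e∈S (subst (Coprime _) (sym n≡2ᵅ⁺¹) (coprime-^ (suc α) (prime∤⇒coprime prime[2] 2∤e)))
        rotation-case e∈S 4∤e (yes (ℕᵈ.divides q e≡q*2)) =
          vertex-∌a² (rot-gcd {2} {q} {2 ^ α} 2q∈S (subst (λ k → Rot S (+ k)) n≡2ᵅ⁺¹ rot-n)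
                                                   (coprime-^ α (prime∤⇒coprime prime[2] 2∤q)))
          where
            2q∈S : Rot S (+ (2 ℕ.* q))
            2q∈S = contains-≡ e∈S (cong +_ (trans e≡q*2 (ℕₚ.*-comm q 2)))
            2∤q : ¬ 2 ℕᵈ.∣ q
            2∤q 2∣q = 4∤e (subst (4 ℕᵈ.∣_) (sym e≡q*2) (ℕᵈ.*-monoˡ-∣ 2 2∣q))

  offset : Bool → ℤ → ℤ
  offset false u = + 0
  offset true u = u

  -- K = ⟨a^d, a^u b⟩: a^x b^s ∈ K exactly when d ∣ x − s·u
  Generated : ℤ → ℤ → Sub n → Set
  Generated d u K = ∀ x → (x ∈ K → d ∣ exponent x - offset (reflects x) u)
                        × (d ∣ exponent x - offset (reflects x) u → x ∈ K)

  generated-unique : ∀ {d u K K′} → Generated d u K → Generated d u K′ → Same K K′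
  generated-unique K=⟨⟩ K′=⟨⟩ x = bool-ext
      (proj₂ (K′=⟨⟩ x) ∘ proj₁ (K=⟨⟩ x)) (proj₂ (K=⟨⟩ x) ∘ proj₁ (K′=⟨⟩ x))
    where
      bool-ext : ∀ {b c : Bool} → (b ≡ true → c ≡ true) → (c ≡ true → b ≡ true) → b ≡ c
      bool-ext {false} {false} _ _ = refl
      bool-ext {false} {true} _ c→b = c→b refl
      bool-ext {true} {_} b→c _ = sym (b→c refl)

  generated-shift : ∀ {d u u′ K} → d ∣ u - u′ → Generated d u K → Generated d u′ K
  generated-shift d∣u-u′ K=⟨⟩ x@(_ , false) = K=⟨⟩ x
  generated-shift {d} {u} {u′} d∣u-u′ K=⟨⟩ x@(i , true) =
      (λ x∈K → subst (d ∣_) (shift ⟦ i ⟧ u u′) (∣m∣n⇒∣m+n (proj₁ (K=⟨⟩ x) x∈K) d∣u-u′))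
    , (λ d∣ → proj₂ (K=⟨⟩ x) (subst (d ∣_) (unshift ⟦ i ⟧ u u′) (∣m∣n⇒∣m-n d∣ d∣u-u′)))
    where
      shift : ∀ x u u′ → (x - u) + (u - u′) ≡ x - u′
      shift = solve-∀
      unshift : ∀ x u u′ → (x - u′) - (u - u′) ≡ x - u
      unshift = solve-∀

  -- A vertex K permuting with ⟨a^u b⟩ whose rotations are exactly the
  -- multiples of an odd divisor d of n is ⟨a^d, a^u b⟩: its reflections
  -- a^v b satisfy d ∣ 2(u − v), hence d ∣ u − v.
  module _ {d : ℤ} (d∣n : d ∣ + n) (halve : ∀ z → d ∣ z * + 2 → d ∣ z)
           {u : ℤ} {K : Sub n} (vertex : Vertex h K) (rotsK : RotationsIn d K) (d∈K : Rot K d)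
           (permutable : Permutable ⟨a^ u b⟩ K) where

    private
      open Subgroup K (proj₁ vertex)
      v : ℤ
      v = proj₁ (Vertex-facts.vertex-reflection vertex)
      v∈K : Ref K v
      v∈K = proj₂ (Vertex-facts.vertex-reflection vertex)

      d∣u-v : d ∣ u - v
      d∣u-v = halve (u - v) (permutable-reflections (⟨a^b⟩-subgroup u) (proj₁ vertex) permutable d∣n
                               (λ z z∈ → ∣-trans d∣n (⟨a^b⟩-rotations u z z∈)) rotsK
                               (⟨a^b⟩-generator u) v∈K)

    neighbour-generated : Generated d u K
    neighbour-generated x@(i , false) =
        (λ x∈K → subst (d ∣_) (sym (ℤₚ.+-identityʳ ⟦ i ⟧)) (rotsK ⟦ i ⟧ (contains-η x∈K)))
      , (λ d∣ → member-η (rot-divisible d∈K (subst (d ∣_) (ℤₚ.+-identityʳ ⟦ i ⟧) d∣)))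
    neighbour-generated x@(i , true) =
        (λ x∈K → subst (d ∣_) (via-v ⟦ i ⟧ u v)
                   (∣m∣n⇒∣m-n (rotsK (⟦ i ⟧ - v) (ref-ref (contains-η x∈K) v∈K)) d∣u-v))
      , (λ d∣ → member-η (contains-≡
                   (rot+ref (rot-divisible d∈K (subst (d ∣_) (to-v ⟦ i ⟧ u v) (∣m∣n⇒∣m+n d∣ d∣u-v))) v∈K)
                   (cancel ⟦ i ⟧ v)))
      where
        via-v : ∀ x u v → (x - v) - (u - v) ≡ x - u
        via-v = solve-∀
        to-v : ∀ x u v → (x - u) + (u - v) ≡ x - v
        to-v = solve-∀
        cancel : ∀ x v → (x - v) + v ≡ x
        cancel = solve-∀

-- Then, by permutable-reflections, "S contains a reflection a^u b with s ∣ u"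
-- passes along every edge of Γ_N(D_n). A Hamiltonian cycle would carry it
-- from {1, b} to {1, ab}, whose only reflection is a^1 b, while s ∤ 1.
module Invariant (m : ℕ) (h : 3 ≤ suc m) where

  open Dihedral m h

  module _ {d : ℤ} {s : ℕ} (d∣n : d ∣ + n) (s∣n : + s ∣ + n) (2≤s : 2 ≤ s)
           (rotations : ∀ S → Vertex h S → RotationsIn d S)
           (halve : ∀ z → d ∣ z * + 2 → + s ∣ z) where

    HasReflectionIn : Sub n → Set
    HasReflectionIn S = ∃ λ u → Ref S u × + s ∣ u

    along-edge : ∀ {H K} → Vertex h H → Vertex h K → Adj H K → HasReflectionIn H → HasReflectionIn K
    along-edge {H} {K} vH vK (_ , HK=KH) (u , u∈H , s∣u) = extend (Vertex-facts.vertex-reflection vK)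
      where
        recover : ∀ u v → u - (u - v) ≡ v
        recover = solve-∀
        extend : ∃ (Ref K) → HasReflectionIn K
        extend (v , v∈K) = v , v∈K , subst (+ s ∣_) (recover u v) (∣m∣n⇒∣m-n s∣u s∣u-v)
          where
            s∣u-v : + s ∣ u - v
            s∣u-v = halve (u - v) (permutable-reflections (proj₁ vH) (proj₁ vK) HK=KH d∣n
                                     (rotations H vH) (rotations K vK) u∈H v∈K)

    ⟨ab⟩-lacks : ¬ HasReflectionIn ⟨a^ + 1 b⟩
    ⟨ab⟩-lacks (u , contains u∈ , s∣u) = ℕₚ.<⇒≱ 2≤s (ℕᵈ.∣⇒≤ (∣⇒∣ᵤ s∣1))
      where
        recover : ∀ u → u - (u - + 1) ≡ + 1
        recover = solve-∀
        s∣1 : + s ∣ + 1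
        s∣1 = subst (+ s ∣_) (recover u)
                (∣m∣n⇒∣m-n s∣u (∣-trans s∣n (difference (⟨a^b⟩-reflection (+ 1) u u∈))))

    transport : ∀ {H K} → Same H K → HasReflectionIn K → HasReflectionIn H
    transport H=K (u , contains u∈K , s∣u) = u , contains (trans (H=K (el u true)) u∈K) , s∣u

    ⟨b⟩-has : HasReflectionIn ⟨a^ + 0 b⟩
    ⟨b⟩-has = + 0 , ⟨a^b⟩-generator (+ 0) , ∣n⇒∣m*n (+ 0) (∣-refl {+ s})

    no-hamiltonian-cycle : ¬ HamiltonianΓN h
    no-hamiltonian-cycle (M , _ , c , vertex , _ , cover , adjacent) =
      along-cycle (cover ⟨a^ + 0 b⟩ (⟨a^b⟩-vertex (+ 0))) (cover ⟨a^ + 1 b⟩ (⟨a^b⟩-vertex (+ 1)))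
      where
        open Cycle M
        along-cycle : (∃ λ i → Same ⟨a^ + 0 b⟩ (c i)) → (∃ λ i → Same ⟨a^ + 1 b⟩ (c i)) → ⊥
        along-cycle (i₀ , at₀) (i₁ , at₁) =
          ⟨ab⟩-lacks (transport at₁ (propagate (λ i → HasReflectionIn (c i))
                                       (λ i → along-edge (vertex i) (vertex (next i)) (adjacent i))
                                       i₀ i₁ (transport (same-sym at₀) ⟨b⟩-has)))

-- A neighbour of ⟨a^u b⟩ (p ∣ u)
-- is either W = ⟨a^p, b⟩ or ⟨a^q, a^u b⟩; since the two cycle-neighbours of
-- a vertex differ, W is a cycle-neighbour of each of ⟨b⟩, ⟨a^p b⟩, ⟨a^2p b⟩,
-- which is one too many.
module Product-of-primes (m : ℕ) (h : 3 ≤ suc m) {p q : ℕ} (p-prime : Prime p) (q-prime : Prime q)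
                         (2<p : 2 < p) (p<q : p < q) (n≡pq : suc m ≡ p ℕ.* q) where

  open Dihedral m h

  private
    2<q : 2 < q
    2<q = ℕₚ.<-trans 2<p p<q

    instance
      p-nonZero : ℕ.NonZero p
      p-nonZero = ℕ.>-nonZero (ℕₚ.<-trans (s≤s z≤n) 2<p)

    q∤p : ¬ q ℕᵈ.∣ p
    q∤p q∣p = ℕₚ.<⇒≱ p<q (ℕᵈ.∣⇒≤ q∣p)

    p⊥q : Coprime p q
    p⊥q = prime∤⇒coprime q-prime q∤p

    n≡qp : n ≡ q ℕ.* p
    n≡qp = trans n≡pq (ℕₚ.*-comm p q)

    divides-n : ∀ {r s} → n ≡ r ℕ.* s → + r ∣ + n
    divides-n {r} {s} n≡rs = ∣ᵤ⇒∣ (subst (r ℕᵈ.∣_) (sym n≡rs) (ℕᵈ.m∣m*n s))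

    halve-prime : ∀ {r} → Prime r → 2 < r → ∀ z → + r ∣ z * + 2 → + r ∣ z
    halve-prime r-prime 2<r = halve-odd (prime⇒coprime r-prime 2<r)

    halve-n : ∀ z → + n ∣ z * + 2 → + n ∣ z
    halve-n = halve-odd (subst (λ k → Coprime k 2) (sym n≡pq)
      (Coprime-sym (coprime-* (Coprime-sym (prime⇒coprime p-prime 2<p)) (Coprime-sym (prime⇒coprime q-prime 2<q)))))

  vertex-rotations : ∀ {K} → Vertex h K → RotationsIn (+ n) K ⊎ Rot K (+ p) ⊎ Rot K (+ q)
  vertex-rotations {K} vertex with Finₚ.any? (λ i → ¬? (toℕ i ℕ.≟ 0) ×-dec (K (i , false) Boolₚ.≟ true))
  ... | no no-rotation = inj₁ trivial
    where
      trivial : RotationsIn (+ n) K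
      trivial z (contains z∈K) = ≡0⇒∣ (≡mod-trans (≡mod-sym (el-exponent z false)) (≡mod-reflexive (cong +_ i≡0)))
        where
          i≡0 : toℕ (proj₁ (el z false)) ≡ 0
          i≡0 = decidable-stable (_ ℕ.≟ 0) λ i≢0 → no-rotation (proj₁ (el z false) , i≢0 , z∈K)
  ... | yes (i , i≢0 , i∈K) = inj₂ (nontrivial (contains-η i∈K) (p ℕᵈ.∣? toℕ i) (q ℕᵈ.∣? toℕ i))
    where
      open Subgroup K (proj₁ vertex)
      open Vertex-rotations vertex using (coprime-rotation-absent)
      nontrivial : Rot K (+ toℕ i) → Dec (p ℕᵈ.∣ toℕ i) → Dec (q ℕᵈ.∣ toℕ i) → Rot K (+ p) ⊎ Rot K (+ q)
      nontrivial _ (yes p∣i) (yes q∣i) =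
        ⊥-elim (≢0-small (ℕₚ.n≢0⇒n>0 i≢0) (Finₚ.toℕ<n i)
                 (∣⇒≡0 (∣ᵤ⇒∣ (subst (ℕᵈ._∣ toℕ i) (sym n≡pq) (coprime-product-∣ p⊥q p∣i q∣i)))))
      nontrivial i∈K (yes p∣i) (no q∤i) = inj₁ (cofactor-rotation q-prime n≡pq i∈K p∣i q∤i)
      nontrivial i∈K (no p∤i) (yes q∣i) = inj₂ (cofactor-rotation p-prime n≡qp i∈K q∣i p∤i)
      nontrivial i∈K (no p∤i) (no q∤i) =
        ⊥-elim (coprime-rotation-absent i∈K
                 (subst (Coprime _) (sym n≡pq) (coprime-* (prime∤⇒coprime p-prime p∤i) (prime∤⇒coprime q-prime q∤i))))

  neighbour-shape : ∀ {u H K} → + p ∣ u → Same ⟨a^ u b⟩ H → Vertex h K → Adj H K →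
                    Generated (+ p) (+ 0) K ⊎ Generated (+ q) u K
  neighbour-shape {u} {H} {K} p∣u ⟨⟩=H vertex (H≠K , HK=KH) = by-rotations (vertex-rotations vertex)
    where
      permutable : Permutable ⟨a^ u b⟩ K
      permutable = permutable-respˡ (same-sym ⟨⟩=H) HK=KH
      by-rotations : RotationsIn (+ n) K ⊎ Rot K (+ p) ⊎ Rot K (+ q) → Generated (+ p) (+ 0) K ⊎ Generated (+ q) u K
      -- trivial rotations would make K = ⟨a^n, a^u b⟩ = ⟨a^u b⟩
      by-rotations (inj₁ trivial) = ⊥-elim (H≠K (same-trans (same-sym ⟨⟩=H) (generated-unique ⟨⟩-generated K-generated)))
        where
          K-generated : Generated (+ n) u K
          K-generated = neighbour-generated ∣-refl halve-n vertex trivial (Subgroup.rot-n K (proj₁ vertex)) permutable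
          ⟨⟩-generated : Generated (+ n) u ⟨a^ u b⟩
          ⟨⟩-generated = neighbour-generated ∣-refl halve-n (⟨a^b⟩-vertex u) (⟨a^b⟩-rotations u)
                           (Subgroup.rot-n ⟨a^ u b⟩ (⟨a^b⟩-subgroup u)) (λ x → id , id)
      by-rotations (inj₂ (inj₁ p∈K)) =
        inj₁ (generated-shift {u = u} (subst (+ p ∣_) (sym (ℤₚ.+-identityʳ u)) p∣u)
               (neighbour-generated (divides-n n≡pq) (halve-prime p-prime 2<p) vertex
                  (Vertex-rotations.prime-rotations vertex p-prime p∈K) p∈K permutable))
      by-rotations (inj₂ (inj₂ q∈K)) =
        inj₂ (neighbour-generated (divides-n n≡qp) (halve-prime q-prime 2<q) vertex
               (Vertex-rotations.prime-rotations vertex q-prime q∈K) q∈K permutable)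

  module _ (M : ℕ) (3≤N : 3 ≤ suc M) (c : Fin (suc M) → Sub n) (vertex : ∀ i → Vertex h (c i))
           (injective : ∀ i j → Same (c i) (c j) → i ≡ j) (adjacent : ∀ i → Adj (c i) (c (next i))) where

    open Cycle M

    IsW : Fin N → Set
    IsW j = Generated (+ p) (+ 0) (c j)

    W-unique : ∀ {j j′} → IsW j → IsW j′ → j ≡ j′
    W-unique W W′ = injective _ _ (generated-unique W W′)

    -- ⟨a^u b⟩ with p ∣ u is a cycle-neighbour of W: its two cycle-neighbours
    -- are distinct, so they cannot both be ⟨a^q, a^u b⟩
    W-neighbour : ∀ {u i} → + p ∣ u → Same ⟨a^ u b⟩ (c i) → ∃ λ j → IsW j × Neighbour j i
    W-neighbour {u} {i} p∣u ⟨⟩=ci = choose (shape (next i) (adjacent i)) (shape (prev i) adjacent-prev)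
      where
        shape : ∀ j → Adj (c i) (c j) → IsW j ⊎ Generated (+ q) u (c j)
        shape j = neighbour-shape p∣u ⟨⟩=ci (vertex j)
        adjacent-prev : Adj (c i) (c (prev i))
        adjacent-prev = adj-sym (subst (λ k → Adj (c (prev i)) (c k)) (next-prev i) (adjacent (prev i)))
        choose : IsW (next i) ⊎ Generated (+ q) u (c (next i)) → IsW (prev i) ⊎ Generated (+ q) u (c (prev i)) →
                 ∃ λ j → IsW j × Neighbour j i
        choose (inj₁ W) _ = next i , W , inj₁ (sym (prev-next i))
        choose (inj₂ _) (inj₁ W) = prev i , W , inj₂ (sym (next-prev i))
        choose (inj₂ G) (inj₂ G′) =
          ⊥-elim (next²≢id 3≤N i (trans (cong next (injective _ _ (generated-unique G G′))) (next-prev i)))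

    apart : ∀ {k l i j} → Same ⟨a^ + (p ℕ.* k) b⟩ (c i) → Same ⟨a^ + (p ℕ.* l) b⟩ (c j) → k < l → l ≤ 2 → i ≢ j
    apart {k} {l} at-i at-j k<l l≤2 refl =
      small-distinct (ℕₚ.*-monoʳ-< p k<l) pl<n (⟨a^b⟩-injective (same-trans at-i (same-sym at-j)))
      where
        pl<n : p ℕ.* l < n
        pl<n = subst (p ℕ.* l <_) (sym n≡pq) (ℕₚ.≤-<-trans (ℕₚ.*-monoʳ-≤ p l≤2) (ℕₚ.*-monoʳ-< p 2<q))

    three-neighbours : ∀ {i₀ i₁ i₂} → Same ⟨a^ + (p ℕ.* 0) b⟩ (c i₀) → Same ⟨a^ + (p ℕ.* 1) b⟩ (c i₁) →
                       Same ⟨a^ + (p ℕ.* 2) b⟩ (c i₂) → ⊥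
    three-neighbours {i₀} {i₁} {i₂} at₀ at₁ at₂ =
      pigeonhole (W-neighbour (p∣ 0) at₀) (W-neighbour (p∣ 1) at₁) (W-neighbour (p∣ 2) at₂)
      where
        p∣ : ∀ k → + p ∣ + (p ℕ.* k)
        p∣ k = ∣ᵤ⇒∣ (ℕᵈ.m∣m*n k)
        NextToW : Fin N → Set
        NextToW i = ∃ λ j → IsW j × Neighbour j i
        pigeonhole : NextToW i₀ → NextToW i₁ → NextToW i₂ → ⊥
        pigeonhole (j , W , i₀~j) (j₁ , W₁ , i₁~j₁) (j₂ , W₂ , i₂~j₂)
          with at-most-two-neighbours i₀~j (subst (λ x → Neighbour x i₁) (W-unique W₁ W) i₁~j₁)
                                           (subst (λ x → Neighbour x i₂) (W-unique W₂ W) i₂~j₂)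
        ... | inj₁ i₀≡i₁ = apart at₀ at₁ (s≤s z≤n) (s≤s z≤n) i₀≡i₁
        ... | inj₂ (inj₁ i₀≡i₂) = apart at₀ at₂ (s≤s z≤n) ℕₚ.≤-refl i₀≡i₂
        ... | inj₂ (inj₂ i₁≡i₂) = apart at₁ at₂ (s≤s (s≤s z≤n)) ℕₚ.≤-refl i₁≡i₂

  no-hamiltonian-cycle : ¬ HamiltonianΓN h
  no-hamiltonian-cycle (M , 3≤N , c , vertex , injective , cover , adjacent) =
    three-neighbours M 3≤N c vertex injective adjacent (position 0) (position 1) (position 2)
    where
      position : ∀ k → Same ⟨a^ + (p ℕ.* k) b⟩ (c (proj₁ (cover _ (⟨a^b⟩-vertex (+ (p ℕ.* k))))))
      position k = proj₂ (cover _ (⟨a^b⟩-vertex (+ (p ℕ.* k))))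

module _ (m : ℕ) (h : 3 ≤ suc m) where

  open Dihedral m h using (module Vertex-rotations)

  power-of-two-case : ∀ β → suc m ≡ 2 ^ suc (suc β) → ¬ HamiltonianΓN h
  power-of-two-case β n≡2ᵝ⁺² =
    Invariant.no-hamiltonian-cycle m h 4∣n (∣-trans (∣ᵤ⇒∣ (ℕᵈ.divides 2 refl)) 4∣n) ℕₚ.≤-refl
      (λ S vertex → Vertex-rotations.power-of-two-rotations vertex {suc β} n≡2ᵝ⁺²) halve-4
    where
      4∣n : + 4 ∣ + suc m
      4∣n = ∣ᵤ⇒∣ (subst (4 ℕᵈ.∣_) (trans (ℕₚ.*-assoc 2 2 (2 ^ β)) (sym n≡2ᵝ⁺²)) (ℕᵈ.m∣m*n (2 ^ β)))

  odd-prime-power-case : ∀ {p α} → Prime p → 2 < p → suc m ≡ p ^ suc α → ¬ HamiltonianΓN h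
  odd-prime-power-case {p} {α} p-prime 2<p n≡pᵅ⁺¹ =
    Invariant.no-hamiltonian-cycle m h p∣n p∣n (ℕₚ.<⇒≤ 2<p)
      (λ S vertex → Vertex-rotations.prime-power-rotations vertex {α = suc α} p-prime n≡pᵅ⁺¹)
      (halve-odd (prime⇒coprime p-prime 2<p))
    where
      p∣n : + p ∣ + suc m
      p∣n = ∣ᵤ⇒∣ (subst (p ℕᵈ.∣_) (sym n≡pᵅ⁺¹) (ℕᵈ.m∣m*n (p ^ α)))

  prime-power-case : ∀ {p α} → Prime p → suc m ≡ p ^ suc α → ¬ HamiltonianΓN h
  prime-power-case {p} {α} p-prime n≡pᵅ⁺¹ with p ℕ.≟ 2
  ... | no p≢2 = odd-prime-power-case {α = α} p-prime (ℕₚ.≤∧≢⇒< (prime≥2 p-prime) (p≢2 ∘ sym)) n≡pᵅ⁺¹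
  ... | yes refl = two-power α n≡pᵅ⁺¹
    where
      -- 2^1 < 3 ≤ n, so the exponent is at least 2
      two-power : ∀ α → suc m ≡ 2 ^ suc α → ¬ HamiltonianΓN h
      two-power zero n≡2 = ⊥-elim (ℕₚ.<-irrefl refl (subst (2 <_) n≡2 h))
      two-power (suc β) n≡2ᵝ⁺² = power-of-two-case β n≡2ᵝ⁺²

  twice-prime-case : ∀ {p} → Prime p → 2 < p → suc m ≡ 2 ℕ.* p → ¬ HamiltonianΓN h
  twice-prime-case {p} p-prime 2<p n≡2p =
    Invariant.no-hamiltonian-cycle m h p∣n p∣n (ℕₚ.<⇒≤ 2<p)
      (λ S vertex → Vertex-rotations.twice-prime-rotations vertex p-prime n≡2p)
      (halve-odd (prime⇒coprime p-prime 2<p))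
    where
      p∣n : + p ∣ + suc m
      p∣n = ∣ᵤ⇒∣ (subst (p ℕᵈ.∣_) (sym n≡2p) (ℕᵈ.n∣m*n 2))

corollary4p3 : (n : ℕ) → (h : 3 ≤ n) →
    ((∃ λ α → 2 ≤ α × n ≡ 2 ^ α)
      ⊎ (∃ λ p → ∃ λ α → Prime p × 1 ≤ α × n ≡ p ^ α)
      ⊎ (∃ λ p → Prime p × 2 < p × n ≡ 2 ℕ.* p)
      ⊎ (∃ λ p → ∃ λ q → Prime p × Prime q × 2 < p × p < q × n ≡ p ℕ.* q)) →
    ¬ HamiltonianΓN h
corollary4p3 (suc m) h (inj₁ (suc (suc β) , _ , n≡2ᵅ)) = power-of-two-case m h β n≡2ᵅ
corollary4p3 (suc m) h (inj₁ (suc zero , s≤s () , _))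
corollary4p3 (suc m) h (inj₂ (inj₁ (p , suc α , p-prime , _ , n≡pᵅ))) = prime-power-case m h {α = α} p-prime n≡pᵅ
corollary4p3 (suc m) h (inj₂ (inj₂ (inj₁ (p , p-prime , 2<p , n≡2p)))) = twice-prime-case m h p-prime 2<p n≡2p
corollary4p3 (suc m) h (inj₂ (inj₂ (inj₂ (p , q , p-prime , q-prime , 2<p , p<q , n≡pq)))) =
  Product-of-primes.no-hamiltonian-cycle m h p-prime q-prime 2<p p<q n≡pq
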